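{- Let $m\geqslant4$ and let $H$, $x$, $y$, $R$ be as in the context. Then $\langle x,y,R(H)\rangle\leqslant\mathrm{Alt}(H)$.
   Context: Permutations act on the right, written exponentially ($g^\sigma$), and a product $\sigma\rho$ means first $\sigma$ then $\rho$. $\mathrm{Alt}(H)$ is the alternating group on the set $H$. Let $m\geqslant4$ be an integer and $H=\langle a,b\mid a^4=b^2=(ab)^2=1\rangle\times\langle c_1\rangle\times\cdots\times\langle c_{m-3}\rangle$, where $c_1,\dots,c_{m-3}$ are involutions. Put $c_{ -1}=c_0=1$. Let $K=\langle a^2,b,c_1,\dots,c_{m-3}\rangle$ and $h=a\prod_{i=0}^{\lceil(m-5)/2\rceil}c_{2i+1}$. Let $x\in\mathrm{Aut}(H)$ be defined by $a^x=a^{ -1}$, $b^x=ab$, $c_{2i+1}^x=c_{2i+1}$, $c_{2i+2}^x=a^2c_{2i+1}c_{2i+2}$ for $0\leqslant i\leqslant\lfloor(m-5)/2\rfloor$, and additionally $c_{m-3}^x=a^2c_{m-3}$ if $m$ is even. Let $\tau\in\mathrm{Aut}(K)$ be defined by $(a^2)^\tau=b$, $b^\tau=a^2$, $c_{2i+1}^\tau=c_{2i-1}c_{2i}c_{2i+2}$, $c_{2i+2}^\tau=c_{2i-1}c_{2i}c_{2i+1}$ for $0\leqslant i\leqslant\lfloor(m-5)/2\rfloor$, and additionally $c_{m-3}^\tau=c_{m-3}$ if $m$ is even. Let $R$ be the right regular representation of $H$ ($R(g):u\mapsto ug$). Let $y$ be the permutation of $H$ with $k^y=k^\tau$ and $(hk)^y=hk^\tau$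 if $m$ is odd, $(hk)^y=hk^\tau c_{m-3}$ if $m$ is even, for all $k\in K$. -}

module Defs where

open import Data.Nat as ℕ using (ℕ; zero; suc; _∸_; _≡ᵇ_; _%_; _/_)
open import Data.Nat.DivMod using (_mod_)
open import Data.Fin as Fin using (Fin; toℕ)
open import Data.Bool as Bool using (Bool; true; false; _xor_; if_then_else_; _∧_)
open import Data.Vec as Vec using (Vec; zipWith; replicate; tabulate; foldr; lookup)
open import Data.Product using (_×_; _,_; proj₁; proj₂; Σ)
import Data.Product.Properties as ×P
import Data.Vec.Properties as VecP
open import Relation.Nullary using (does; ¬_)
open import Relation.Binary.PropositionalEquality using (_≡_; _≗_)
open import Relation.Binary.Definitions using (DecidableEquality)
open import Function using (id; _∘_)

infixl 6 _+₄_
_+₄_ : Fin 4 → Fin 4 → Fin 4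
i +₄ j = (toℕ i ℕ.+ toℕ j) mod 4

-₄_ : Fin 4 → Fin 4
-₄ i = (4 ∸ toℕ i) mod 4

-- The group H = D₈ × C₂^(m-3), D₈ = ⟨a,b | a⁴=b²=(ab)²=1⟩.
-- An element (i , j , v) is the normal form  a^i b^j c₁^{v₁} ⋯ c_{m-3}^{v_{m-3}}.

data H (m : ℕ) : Set where
  mk : Fin 4 → Bool → Vec Bool (m ∸ 3) → H m

infixl 7 _·_
-- (a^i b^j c^u)(a^k b^l c^v) = a^(i ± k) b^(j+l) c^(u+v), using b a b⁻¹ = a⁻¹
_·_ : ∀ {m} → H m → H m → H m
mk i j u · mk k l v = mk (i +₄ (if j then -₄ k else k)) (j xor l) (zipWith _xor_ u v)

e : ∀ {m} → H m
e = mk Fin.zero false (replicate _ false)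

inv : ∀ {m} → H m → H m
inv (mk i true v) = mk i true v
inv (mk i false v) = mk (-₄ i) false v

_^_ : ∀ {m} → H m → ℕ → H m
g ^ zero = e
g ^ suc n = (g ^ n) · g

a : ∀ {m} → H m
a = mk (Fin.suc Fin.zero) false (replicate _ false)

b : ∀ {m} → H m
b = mk Fin.zero true (replicate _ false)

-- c k = c_k for 1 ≤ k ≤ m-3; c 0 = 1 (this also encodes c₋₁ = c₀ = 1 via ∸)
c : ∀ {m} → ℕ → H m
c k = mk Fin.zero false (tabulate (λ p → suc (toℕ p) ≡ᵇ k))

isEven : ℕ → Bool
isEven n = n % 2 ≡ᵇ 0

cprod : ∀ {m} → (ℕ → H m) → Vec Bool (m ∸ 3) → H m
cprod {m} C v = foldr _ _·_ e (tabulate (λ p → if lookup v p then C (suc (toℕ p)) else e))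

extend : ∀ {m} → H m → H m → (ℕ → H m) → H m → H m
extend A B C (mk i j v) = (A ^ toℕ i) · (if j then B else e) · cprod C v

prodUpTo : ∀ {m} → (ℕ → H m) → ℕ → H m
prodUpTo f zero = f 0
prodUpTo f (suc n) = prodUpTo f n · f (suc n)

xC : ∀ m → ℕ → H m
xC m k = if isEven k then a · a · c (k ∸ 1) · c k
         else (if isEven m ∧ (k ≡ᵇ (m ∸ 3)) then a · a · c k else c k)

xmap : ∀ m → H m → H m
xmap m = extend (a ^ 3) (a · b) (xC m)

-- K = ⟨a², b, c_k⟩ (elements with even a-exponent) and τ ∈ Aut(K)

inK : ∀ {m} → H m → Bool
inK (mk i _ _) = isEven (toℕ i)

τC : ∀ m → ℕ → H m
τC m k = if isEven k then c (k ∸ 3) · c (k ∸ 2) · c (k ∸ 1)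
         else (if isEven m ∧ (k ≡ᵇ (m ∸ 3)) then c k
               else c (k ∸ 2) · c (k ∸ 1) · c (suc k))

τmap : ∀ m → H m → H m
τmap m (mk i j v) = (b ^ (toℕ i / 2)) · (if j then a · a else e) · cprod (τC m) v

-- h = a ∏_{i=0}^{⌈(m-5)/2⌉} c_{2i+1};  for m ≥ 4, ⌈(m-5)/2⌉ = ⌊(m-4)/2⌋
h : ∀ m → H m
h m = a · prodUpTo (λ i → c (suc (2 ℕ.* i))) ((m ∸ 4) / 2)

ymap : ∀ m → H m → H m
ymap m g = if inK g then τmap m g
           else h m · τmap m (inv (h m) · g) · (if isEven m then c (m ∸ 3) else e)

R : ∀ {m} → H m → H m → H m
R g u = u · g

-- Permutations of H as functions; composition "first f then g" is g ∘ f.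

_==_ : ∀ {m} → H m → H m → Bool
mk i j u == mk k l v = does (i Fin.≟ k) ∧ does (j Bool.≟ l) ∧ does (VecP.≡-dec Bool._≟_ u v)

swap : ∀ {m} → H m → H m → H m → H m
swap u v w = if w == u then v else (if w == v then u else w)

data EvenProd (m : ℕ) : (H m → H m) → Set where
  ep-id   : EvenProd m id
  ep-step : ∀ {f} (u v u′ v′ : H m) → ¬ (u ≡ v) → ¬ (u′ ≡ v′) →
            EvenProd m f → EvenProd m (swap u′ v′ ∘ swap u v ∘ f)

InAlt : ∀ m → (H m → H m) → Set
InAlt m σ = Σ (H m → H m) (λ f → EvenProd m f × (σ ≗ f))

data InGen (m : ℕ) : (H m → H m) → Set where
  gen-x   : InGen m (xmap m)
  gen-y   : InGen m (ymap m)
  gen-R   : ∀ g → InGen m (R g)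
  gen-id  : InGen m id
  gen-mul : ∀ {f g} → InGen m f → InGen m g → InGen m (g ∘ f)
  gen-inv : ∀ {f f′} → InGen m f → (∀ w → f′ (f w) ≡ w) → (∀ w → f (f′ w) ≡ w) → InGen m f′
  gen-ext : ∀ {f g} → InGen m f → f ≗ g → InGen m g

-- Write H = D₈ × 𝔽₂^(m-3) and view a permutation of H as a permutation of pairs (d , v).
-- Each of x, y and R(g) is a composite of two fibrewise permutations: one moves d by a
-- permutation ψ_v of D₈ whose parity does not depend on v, the other moves v by a
-- permutation μ_d of 𝔽₂^(m-3) that depends only on the a-exponent of d. (The c-part of
-- x, and of τ on K, is an involutive linear map, hence a bijection.) A fibrewise
-- permutation is a product of the permutations of the single fibres, so its parity is
-- the sum of the fibre parities. The first kind has 2^(m-3) fibres, an even number as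
-- m ≥ 4; in the second kind every μ_d occurs twice, for b-exponent 0 and 1. So the
-- generators, and with them all of ⟨x, y, R(H)⟩, are even. Parities are witnessed by
-- explicit decompositions into transpositions; no sign homomorphism is needed.

module Submission where

open import Defs
open import Data.Bool using (Bool; true; false; if_then_else_; _xor_; _∧_)
import Data.Bool as Bool
open import Data.Bool.Properties
  using (xor-identityˡ; xor-identityʳ; xor-assoc; xor-comm; xor-same; ∧-zeroʳ; ∧-identityʳ; ∧-comm)
open import Data.Fin using (Fin)
import Data.Fin as Fin
open import Data.Fin.Patterns using (0F; 1F; 2F; 3F)
open import Data.List using (List; []; _∷_; map; cartesianProduct; allFin)
open import Data.List.Membership.Propositional using (_∈_; _∉_)
open import Data.List.Membership.Propositional.Properties using (∈-map⁺; ∈-cartesianProduct⁺; ∈-allFin)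
import Data.List.Relation.Unary.All as All
open All using ([]; _∷_)
open import Data.List.Relation.Unary.AllPairs using ([]; _∷_)
open import Data.List.Relation.Unary.Any using (here; there)
open import Data.List.Relation.Unary.Unique.Propositional using (Unique)
open import Data.List.Relation.Unary.Unique.Propositional.Properties
  using (map⁺; cartesianProduct⁺; allFin⁺; Unique[x∷xs]⇒x∉xs)
open import Data.Nat as ℕ using (ℕ; zero; suc; _∸_; _≡ᵇ_; _<ᵇ_; _/_; _≤_; z≤n; s≤s)
open import Data.Parity.Base using (Parity; 0ℙ; 1ℙ; _+_)
import Data.Parity.Properties as ℙ
open import Data.Product using (Σ; ∃; _×_; _,_; proj₁; proj₂) renaming (swap to ×-swap)
open import Data.Product.Properties using () renaming (≡-dec to ×-≡-dec)
open import Data.Vec using (Vec; []; _∷_; zipWith; replicate; tabulate; foldr; lookup)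
import Data.Vec.Properties as Vec
open import Function using (id; _∘_; const)
open import Function.Definitions using (Injective)
open import Relation.Binary.Definitions using (DecidableEquality)
open import Relation.Binary.PropositionalEquality
open import Relation.Nullary using (Dec; yes; no; does; contradiction)
open import Relation.Nullary.Decidable
  using (True; toWitness; map′; _×-dec_; _→-dec_; dec-true; dec-false)

involutive⇒injective : ∀ {a} {X : Set a} {f : X → X} → (∀ x → f (f x) ≡ x) → Injective _≡_ _≡_ f
involutive⇒injective {f = f} f∘f≗id {x} {y} eq = trans (sym (f∘f≗id x)) (trans (cong f eq) (f∘f≗id y))

-- Parity of permutations

module Transpositions {a} {X : Set a} (_≟_ : DecidableEquality X) where

  transpose : X → X → X → X
  transpose u v w = if does (w ≟ u) then v else if does (w ≟ v) then u else w

  transpose-left : ∀ u v → transpose u v u ≡ v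
  transpose-left u v rewrite dec-true (u ≟ u) refl = refl

  transpose-right : ∀ u v → transpose u v v ≡ u
  transpose-right u v with v ≟ u
  ... | yes v≡u = v≡u
  ... | no _ rewrite dec-true (v ≟ v) refl = refl

  transpose-other : ∀ {u v w} → w ≢ u → w ≢ v → transpose u v w ≡ w
  transpose-other {u} {v} {w} w≢u w≢v rewrite dec-false (w ≟ u) w≢u | dec-false (w ≟ v) w≢v = refl

  transpose-same : ∀ u w → transpose u u w ≡ w
  transpose-same u w with w ≟ u
  ... | yes refl = refl
  ... | no _     = refl

  transpose-involutive : ∀ u v w → transpose u v (transpose u v w) ≡ w
  transpose-involutive u v w with w ≟ u | w ≟ v
  ... | yes refl | _        = transpose-right w v
  ... | no _     | yes refl = transpose-left u w
  ... | no w≢u   | no w≢v   = transpose-other w≢u w≢v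

  transpose-injective : ∀ u v → Injective _≡_ _≡_ (transpose u v)
  transpose-injective u v = involutive⇒injective (transpose-involutive u v)

  data HasParity : (X → X) → Parity → Set a where
    even-id     : HasParity id 0ℙ
    transpose-∘ : ∀ {f p} u v → u ≢ v → HasParity f p → HasParity (transpose u v ∘ f) (1ℙ + p)
    resp-≗      : ∀ {f g p} → f ≗ g → HasParity f p → HasParity g p

  ∘-hasParity : ∀ {f g p q} → HasParity f p → HasParity g q → HasParity (g ∘ f) (q + p)
  ∘-hasParity F even-id = F
  ∘-hasParity {p = p} F (transpose-∘ {p = q} u v u≢v G) =
    subst (HasParity _) (sym (ℙ.+-assoc 1ℙ q p)) (transpose-∘ u v u≢v (∘-hasParity F G))
  ∘-hasParity {f} F (resp-≗ g≗g′ G) = resp-≗ (g≗g′ ∘ f) (∘-hasParity F G)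

  transposition-odd : ∀ {u v} → u ≢ v → HasParity (transpose u v) 1ℙ
  transposition-odd u≢v = transpose-∘ _ _ u≢v even-id

  leftInverse-hasParity : ∀ {f p} → HasParity f p → ∃ λ g → HasParity g p × g ∘ f ≗ id
  leftInverse-hasParity even-id = id , even-id , λ _ → refl
  leftInverse-hasParity (transpose-∘ {f} {p} u v u≢v F) with g , G , g∘f≗id ← leftInverse-hasParity F =
    g ∘ transpose u v ,
    subst (HasParity _) (ℙ.+-comm p 1ℙ) (∘-hasParity (transposition-odd u≢v) G) ,
    λ w → trans (cong g (transpose-involutive u v (f w))) (g∘f≗id w)
  leftInverse-hasParity (resp-≗ f≗f′ F) with g , G , g∘f≗id ← leftInverse-hasParity F =
    g , G , λ w → trans (cong g (sym (f≗f′ w))) (g∘f≗id w)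

  rightInverse-hasParity : ∀ {f g p} → HasParity f p → f ∘ g ≗ id → HasParity g p
  rightInverse-hasParity {f} {g} F f∘g≗id with f⁻ , F⁻ , f⁻∘f≗id ← leftInverse-hasParity F =
    resp-≗ (λ w → trans (cong f⁻ (sym (f∘g≗id w))) (f⁻∘f≗id (g w))) F⁻

  fixesOutside⇒hasParity : ∀ L f → Injective _≡_ _≡_ f → (∀ w → w ∉ L → f w ≡ w) → ∃ (HasParity f)
  fixesOutside⇒hasParity [] f _ fixed = 0ℙ , resp-≗ (λ w → sym (fixed w λ ())) even-id
  fixesOutside⇒hasParity (x ∷ L) f f-inj fixed =
    restore (x ≟ f x) (fixesOutside⇒hasParity L f′ f′-inj f′-fixed)
    where
      f′ : X → X
      f′ = transpose x (f x) ∘ f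

      f′-inj : Injective _≡_ _≡_ f′
      f′-inj = f-inj ∘ transpose-injective x (f x)

      f′-fixed : ∀ w → w ∉ L → f′ w ≡ w
      f′-fixed w w∉L with w ≟ x
      ... | yes refl = transpose-right w (f w)
      ... | no w≢x = trans (cong (transpose x (f x)) fw≡w)
                           (transpose-other w≢x λ w≡fx → w≢x (f-inj (trans fw≡w w≡fx)))
        where
          fw≡w : f w ≡ w
          fw≡w = fixed w λ { (here w≡x) → w≢x w≡x ; (there w∈L) → w∉L w∈L }

      restore : Dec (x ≡ f x) → ∃ (HasParity f′) → ∃ (HasParity f)
      restore (yes x≡fx) (p , F′) =
        p , resp-≗ (λ w → trans (cong (λ y → transpose x y (f w)) (sym x≡fx)) (transpose-same x (f w))) F′
      restore (no x≢fx) (p , F′) =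
        1ℙ + p , resp-≗ (λ w → transpose-involutive x (f x) (f w)) (transpose-∘ x (f x) x≢fx F′)

  injective⇒hasParity : ∀ {L} → (∀ x → x ∈ L) → ∀ f → Injective _≡_ _≡_ f → ∃ (HasParity f)
  injective⇒hasParity {L} complete f f-inj =
    fixesOutside⇒hasParity L f f-inj λ w w∉L → contradiction (complete w) w∉L

module _ {a b} {X : Set a} {Y : Set b} (_≟X_ : DecidableEquality X) (_≟Y_ : DecidableEquality Y) where
  private
    module TX = Transpositions _≟X_
    module TY = Transpositions _≟Y_

  transpose-natural : ∀ (h : Y → X) → Injective _≡_ _≡_ h →
                      ∀ u v w → h (TY.transpose u v w) ≡ TX.transpose (h u) (h v) (h w)
  transpose-natural h h-inj u v w with w ≟Y u | w ≟Y v
  ... | yes refl | _        = sym (TX.transpose-left (h w) (h v))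
  ... | no _     | yes refl = sym (TX.transpose-right (h u) (h w))
  ... | no w≢u   | no w≢v   = sym (TX.transpose-other (w≢u ∘ h-inj) (w≢v ∘ h-inj))

  conjugate-hasParity : ∀ {f p} (φ : X → Y) (φ⁻ : Y → X) → φ ∘ φ⁻ ≗ id → φ⁻ ∘ φ ≗ id →
                        TY.HasParity f p → TX.HasParity (φ⁻ ∘ f ∘ φ) p
  conjugate-hasParity φ φ⁻ φ∘φ⁻≗id φ⁻∘φ≗id = go
    where
      φ⁻-inj : Injective _≡_ _≡_ φ⁻
      φ⁻-inj {y} {y′} eq = trans (sym (φ∘φ⁻≗id y)) (trans (cong φ eq) (φ∘φ⁻≗id y′))

      go : ∀ {f p} → TY.HasParity f p → TX.HasParity (φ⁻ ∘ f ∘ φ) p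
      go TY.even-id = TX.resp-≗ (sym ∘ φ⁻∘φ≗id) TX.even-id
      go (TY.transpose-∘ {f} u v u≢v F) =
        TX.resp-≗ (λ x → sym (transpose-natural φ⁻ φ⁻-inj u v (f (φ x))))
                  (TX.transpose-∘ (φ⁻ u) (φ⁻ v) (u≢v ∘ φ⁻-inj) (go F))
      go (TY.resp-≗ f≗g F) = TX.resp-≗ (cong φ⁻ ∘ f≗g ∘ φ) (go F)

-- Finite enumerations

record Enumeration {a} (X : Set a) : Set a where
  field
    elements : List X
    unique   : Unique elements
    complete : ∀ x → x ∈ elements

open Enumeration

Bool-enumeration : Enumeration Bool
Bool-enumeration = record
  { elements = true ∷ false ∷ []
  ; unique   = ((λ ()) ∷ []) ∷ [] ∷ []
  ; complete = λ { true → here refl ; false → there (here refl) }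
  }

Fin-enumeration : ∀ n → Enumeration (Fin n)
Fin-enumeration n = record { elements = allFin n ; unique = allFin⁺ n ; complete = ∈-allFin }

module _ {a b} {A : Set a} {B : Set b} where

  ×-enumeration : Enumeration A → Enumeration B → Enumeration (A × B)
  ×-enumeration EA EB = record
    { elements = cartesianProduct (elements EA) (elements EB)
    ; unique   = cartesianProduct⁺ (unique EA) (unique EB)
    ; complete = λ (x , y) → ∈-cartesianProduct⁺ (complete EA x) (complete EB y)
    }

  map-enumeration : (f : A → B) (g : B → A) → Injective _≡_ _≡_ f → f ∘ g ≗ id →
                    Enumeration A → Enumeration B
  map-enumeration f g f-inj f∘g≗id EA = record
    { elements = map f (elements EA)
    ; unique   = map⁺ f-inj (unique EA)
    ; complete = λ y → subst (_∈ _) (f∘g≗id y) (∈-map⁺ f (complete EA (g y)))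
    }

Vec-enumeration : ∀ {a} {A : Set a} → Enumeration A → ∀ n → Enumeration (Vec A n)
Vec-enumeration EA zero    = record { elements = [] ∷ [] ; unique = [] ∷ [] ; complete = λ { [] → here refl } }
Vec-enumeration EA (suc n) =
  map-enumeration (λ (v , x) → x ∷ v) (λ { (x ∷ v) → v , x })
    (λ eq → let x≡y , v≡w = Vec.∷-injective eq in cong₂ _,_ v≡w x≡y) (λ { (_ ∷ _) → refl })
    (×-enumeration (Vec-enumeration EA n) EA)

∀? : ∀ {a p} {X : Set a} {P : X → Set p} → Enumeration X → (∀ x → Dec (P x)) → Dec (∀ x → P x)
∀? E P? = map′ (λ all x → All.lookup all (complete E x)) (λ ∀P → All.tabulate λ {x} _ → ∀P x)
               (All.all? P? (elements E))

injective? : ∀ {a} {X : Set a} → Enumeration X → DecidableEquality X → (f : X → X) →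
             Dec (Injective _≡_ _≡_ f)
injective? E _≟_ f = map′ (λ inj {x} {y} → inj (x , y)) (λ inj _ → inj)
                          (∀? (×-enumeration E E) λ (x , y) → (f x ≟ f y) →-dec (x ≟ y))

paritySum : ∀ {a} {X : Set a} → (X → Parity) → List X → Parity
paritySum p []      = 0ℙ
paritySum p (x ∷ L) = p x + paritySum p L

paritySum-map : ∀ {a b} {A : Set a} {B : Set b} (p : B → Parity) (f : A → B) L →
                paritySum p (map f L) ≡ paritySum (p ∘ f) L
paritySum-map p f []      = refl
paritySum-map p f (x ∷ L) = cong (p (f x) +_) (paritySum-map p f L)

paritySum-doubled : ∀ {a} {A : Set a} (q : A → Parity) L →
                    paritySum (q ∘ proj₁) (cartesianProduct L (elements Bool-enumeration)) ≡ 0ℙ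
paritySum-doubled q []      = refl
paritySum-doubled q (x ∷ L) = begin
  q x + (q x + rest)   ≡⟨ ℙ.+-assoc (q x) (q x) rest ⟨
  (q x + q x) + rest   ≡⟨ cong (_+ rest) (ℙ.p+p≡0ℙ (q x)) ⟩
  rest                 ≡⟨ paritySum-doubled q L ⟩
  0ℙ                   ∎
  where
    open ≡-Reasoning
    rest = paritySum (q ∘ proj₁) (cartesianProduct L (elements Bool-enumeration))

paritySum-const-Vec : ∀ q n → paritySum (const q) (elements (Vec-enumeration Bool-enumeration (suc n))) ≡ 0ℙ
paritySum-const-Vec q n =
  trans (paritySum-map (const q) _ (elements (×-enumeration (Vec-enumeration Bool-enumeration n) Bool-enumeration)))
        (paritySum-doubled (const q) (elements (Vec-enumeration Bool-enumeration n)))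

-- Fibrewise permutations of a product

module _ {a b} {A : Set a} {B : Set b} where

  fibrewise₁ : (B → A → A) → A × B → A × B
  fibrewise₁ ψ (x , b) = (ψ b x , b)

  fibrewise₂ : (A → B → B) → A × B → A × B
  fibrewise₂ μ (x , b) = (x , μ x b)

module Fibrewise {a b} {A : Set a} {B : Set b}
                 (_≟A_ : DecidableEquality A) (_≟B_ : DecidableEquality B) where
  private
    module TA = Transpositions _≟A_
  open Transpositions (×-≡-dec _≟A_ _≟B_)

  onFibre : B → (A → A) → A × B → A × B
  onFibre b π (x , b′) = if does (b′ ≟B b) then (π x , b′) else (x , b′)

  onFibre-hasParity : ∀ b {π p} → TA.HasParity π p → HasParity (onFibre b π) p
  onFibre-hasParity b TA.even-id = resp-≗ onFibre-id even-id
    where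
      onFibre-id : id ≗ onFibre b id
      onFibre-id (x , b′) with does (b′ ≟B b)
      ... | true  = refl
      ... | false = refl
  onFibre-hasParity b (TA.transpose-∘ {π} s t s≢t P) =
    resp-≗ transpose-onFibre (transpose-∘ (s , b) (t , b) (s≢t ∘ cong proj₁) (onFibre-hasParity b P))
    where
      transpose-onFibre : transpose (s , b) (t , b) ∘ onFibre b π ≗ onFibre b (TA.transpose s t ∘ π)
      transpose-onFibre (x , b′) with b′ ≟B b
      ... | yes refl = sym (transpose-natural (×-≡-dec _≟A_ _≟B_) _≟A_ (_, b′) (cong proj₁) s t (π x))
      ... | no b′≢b  = transpose-other (b′≢b ∘ cong proj₂) (b′≢b ∘ cong proj₂)
  onFibre-hasParity b (TA.resp-≗ {π} {π′} π≗π′ P) = resp-≗ onFibre-≗ (onFibre-hasParity b P)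
    where
      onFibre-≗ : onFibre b π ≗ onFibre b π′
      onFibre-≗ (x , b′) with does (b′ ≟B b)
      ... | true  = cong (_, b′) (π≗π′ x)
      ... | false = refl

  alongList : List B → (B → A → A) → A × B → A × B
  alongList []      ψ = id
  alongList (b ∷ L) ψ = onFibre b (ψ b) ∘ alongList L ψ

  alongList-∉ : ∀ {L b} ψ x → b ∉ L → alongList L ψ (x , b) ≡ (x , b)
  alongList-∉ {[]}        ψ x b∉L = refl
  alongList-∉ {c ∷ L} {b} ψ x b∉L
    rewrite alongList-∉ ψ x (b∉L ∘ there) | dec-false (b ≟B c) (b∉L ∘ here) = refl

  alongList-∈ : ∀ {L b} ψ x → Unique L → b ∈ L → alongList L ψ (x , b) ≡ (ψ b x , b)
  alongList-∈ {c ∷ L} ψ x uniq (here refl)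
    rewrite alongList-∉ ψ x (Unique[x∷xs]⇒x∉xs uniq) | dec-true (c ≟B c) refl = refl
  alongList-∈ {c ∷ L} {b} ψ x (c≢L ∷ uniq) (there b∈L)
    rewrite alongList-∈ ψ x uniq b∈L | dec-false (b ≟B c) (All.lookup c≢L b∈L ∘ sym) = refl

  alongList-hasParity : ∀ {ψ p} → (∀ b → TA.HasParity (ψ b) (p b)) →
                        ∀ L → HasParity (alongList L ψ) (paritySum p L)
  alongList-hasParity Ψ []      = even-id
  alongList-hasParity Ψ (b ∷ L) = ∘-hasParity (alongList-hasParity Ψ L) (onFibre-hasParity b (Ψ b))

  fibrewise₁-hasParity : ∀ {ψ p} (E : Enumeration B) → (∀ b → TA.HasParity (ψ b) (p b)) →
                         HasParity (fibrewise₁ ψ) (paritySum p (elements E))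
  fibrewise₁-hasParity {ψ} E Ψ =
    resp-≗ (λ (x , b) → alongList-∈ ψ x (unique E) (complete E b)) (alongList-hasParity Ψ (elements E))

module _ {a b} {A : Set a} {B : Set b} (_≟A_ : DecidableEquality A) (_≟B_ : DecidableEquality B) where
  private
    module TB = Transpositions _≟B_
  open Transpositions (×-≡-dec _≟A_ _≟B_)

  fibrewise₂-hasParity : ∀ {μ p} (E : Enumeration A) → (∀ x → TB.HasParity (μ x) (p x)) →
                         HasParity (fibrewise₂ μ) (paritySum p (elements E))
  fibrewise₂-hasParity E M =
    conjugate-hasParity (×-≡-dec _≟A_ _≟B_) (×-≡-dec _≟B_ _≟A_) ×-swap ×-swap (λ _ → refl) (λ _ → refl)
      (Fibrewise.fibrewise₁-hasParity _≟B_ _≟A_ E M)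

-- The dihedral group D₈

D : Set
D = Fin 4 × Bool

infixl 7 _∙_
_∙_ : D → D → D
(i , j) ∙ (k , l) = (i +₄ (if j then -₄ k else k) , j xor l)

1ᴰ aᴰ bᴰ : D
1ᴰ = 0F , false
aᴰ = 1F , false
bᴰ = 0F , true

infixl 8 _^ᴰ_
_^ᴰ_ : D → ℕ → D
d ^ᴰ zero  = 1ᴰ
d ^ᴰ suc n = d ^ᴰ n ∙ d

_≟D_ : DecidableEquality D
_≟D_ = ×-≡-dec Fin._≟_ Bool._≟_

D-enumeration : Enumeration D
D-enumeration = ×-enumeration (Fin-enumeration 4) Bool-enumeration

∙-identityʳ : ∀ d → d ∙ 1ᴰ ≡ d
∙-identityʳ = toWitness {a? = ∀? D-enumeration λ d → (d ∙ 1ᴰ) ≟D d} _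

open Transpositions _≟D_ using () renaming (HasParity to HasParityᴰ; ∘-hasParity to ∘-hasParityᴰ)

-- for a concrete f both the injectivity check and the parity evaluate by normalisation
hasParityᴰ : (f : D → D) → {True (injective? D-enumeration _≟D_ f)} → ∃ (HasParityᴰ f)
hasParityᴰ f {f-inj} = Transpositions.injective⇒hasParity _≟D_ (complete D-enumeration) f (toWitness f-inj)

rightMul-even : ∀ g → HasParityᴰ (_∙ g) 0ℙ
rightMul-even (0F , false) = proj₂ (hasParityᴰ _)
rightMul-even (0F , true)  = proj₂ (hasParityᴰ _)
rightMul-even (1F , false) = proj₂ (hasParityᴰ _)
rightMul-even (1F , true)  = proj₂ (hasParityᴰ _)
rightMul-even (2F , false) = proj₂ (hasParityᴰ _)
rightMul-even (2F , true)  = proj₂ (hasParityᴰ _)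
rightMul-even (3F , false) = proj₂ (hasParityᴰ _)
rightMul-even (3F , true)  = proj₂ (hasParityᴰ _)

-- 𝔽₂-vectors and the linear parts of x and τ

infixl 6 _⊕_
_⊕_ : ∀ {n} → Vec Bool n → Vec Bool n → Vec Bool n
_⊕_ = zipWith _xor_

0⃗ : ∀ {n} → Vec Bool n
0⃗ = replicate _ false

⊕-identityˡ : ∀ {n} (u : Vec Bool n) → 0⃗ ⊕ u ≡ u
⊕-identityˡ = Vec.zipWith-identityˡ xor-identityˡ

⊕-assoc : ∀ {n} (u v w : Vec Bool n) → (u ⊕ v) ⊕ w ≡ u ⊕ (v ⊕ w)
⊕-assoc = Vec.zipWith-assoc xor-assoc

⊕-comm : ∀ {n} (u v : Vec Bool n) → u ⊕ v ≡ v ⊕ u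
⊕-comm = Vec.zipWith-comm xor-comm

⊕-self : ∀ {n} (u : Vec Bool n) → u ⊕ u ≡ 0⃗
⊕-self []      = refl
⊕-self (x ∷ u) = cong₂ _∷_ (xor-same x) (⊕-self u)

⊕-cancelˡ : ∀ {n} (u v : Vec Bool n) → u ⊕ (u ⊕ v) ≡ v
⊕-cancelˡ u v = trans (sym (⊕-assoc u u v)) (trans (cong (_⊕ v) (⊕-self u)) (⊕-identityˡ v))

⊕-injectiveˡ : ∀ {n} (w : Vec Bool n) → Injective _≡_ _≡_ (w ⊕_)
⊕-injectiveˡ w {u} {v} eq = trans (sym (⊕-cancelˡ w u)) (trans (cong (w ⊕_) eq) (⊕-cancelˡ w v))

⊕-injectiveʳ : ∀ {n} (w : Vec Bool n) → Injective _≡_ _≡_ (_⊕ w)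
⊕-injectiveʳ w {u} {v} eq = ⊕-injectiveˡ w (trans (⊕-comm w u) (trans eq (⊕-comm v w)))

0⃗-⊕-0⃗-⊕ : ∀ {n} (u w r : Vec Bool n) → u ≡ 0⃗ → w ≡ 0⃗ → u ⊕ (w ⊕ r) ≡ r
0⃗-⊕-0⃗-⊕ _ _ r refl refl = trans (⊕-identityˡ _) (⊕-identityˡ r)

xor-cancelʳ : ∀ x y → (x xor y) xor y ≡ x
xor-cancelʳ x y = trans (xor-assoc x y y) (trans (cong (x xor_) (xor-same y)) (xor-identityʳ x))

-- Coordinates are numbered from 1, like c₁, …, c_{m-3}; index 0 plays the role of c₀ = 1.
unit : ∀ {n} → ℕ → Vec Bool n
unit k = tabulate (λ p → suc (Fin.toℕ p) ≡ᵇ k)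

unit-zero : ∀ {n} → unit {n} 0 ≡ 0⃗
unit-zero {zero}  = refl
unit-zero {suc n} = cong (false ∷_) unit-zero

lincomb : ∀ {n k} → (ℕ → Vec Bool n) → Vec Bool k → Vec Bool n
lincomb W []      = 0⃗
lincomb W (x ∷ v) = (if x then W 1 else 0⃗) ⊕ lincomb (W ∘ suc) v

lincomb-cong : ∀ {n k} {W W′ : ℕ → Vec Bool n} → (∀ i → W (suc i) ≡ W′ (suc i)) →
               (v : Vec Bool k) → lincomb W v ≡ lincomb W′ v
lincomb-cong W≗W′ []      = refl
lincomb-cong W≗W′ (x ∷ v) = cong₂ (λ w l → (if x then w else 0⃗) ⊕ l) (W≗W′ 0) (lincomb-cong (W≗W′ ∘ suc) v)

dot : ∀ {k} → (ℕ → Bool) → Vec Bool k → Bool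
dot h []      = false
dot h (x ∷ v) = (x ∧ h 1) xor dot (h ∘ suc) v

dot-false : ∀ {k} {h : ℕ → Bool} → (∀ i → h (suc i) ≡ false) → (v : Vec Bool k) → dot h v ≡ false
dot-false h≡false []      = refl
dot-false h≡false (x ∷ v) rewrite h≡false 0 | ∧-zeroʳ x = dot-false (h≡false ∘ suc) v

lincomb-shift : ∀ {n k} {W : ℕ → Vec Bool (2 ℕ.+ n)} {W′ : ℕ → Vec Bool n} {h₁ h₂ : ℕ → Bool} →
                (∀ i → W (suc i) ≡ h₁ (suc i) ∷ h₂ (suc i) ∷ W′ (suc i)) →
                (v : Vec Bool k) → lincomb W v ≡ dot h₁ v ∷ dot h₂ v ∷ lincomb W′ v
lincomb-shift W≡ []      = refl
lincomb-shift W≡ (x ∷ v) rewrite W≡ 0 with x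
... | true  = cong (_ ⊕_) (lincomb-shift (W≡ ∘ suc) v)
... | false = cong (0⃗ ⊕_) (lincomb-shift (W≡ ∘ suc) v)

-- c_{2i+1} ↦ c_{2i+1}, c_{2i+2} ↦ c_{2i+1} c_{2i+2}
xᶜ : ∀ {n} → Vec Bool n → Vec Bool n
xᶜ []          = []
xᶜ (x ∷ [])    = x ∷ []
xᶜ (x ∷ y ∷ v) = (x xor y) ∷ y ∷ xᶜ v

xᶜ-involutive : ∀ {n} (v : Vec Bool n) → xᶜ (xᶜ v) ≡ v
xᶜ-involutive []          = refl
xᶜ-involutive (x ∷ [])    = refl
xᶜ-involutive (x ∷ y ∷ v) = cong₂ (λ z w → z ∷ y ∷ w) (xor-cancelʳ x y) (xᶜ-involutive v)

xᶜ-injective : ∀ {n} → Injective _≡_ _≡_ (xᶜ {n})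
xᶜ-injective = involutive⇒injective xᶜ-involutive

c^x : ∀ n → ℕ → Vec Bool n
c^x n k = if isEven k then unit (k ∸ 1) ⊕ unit k else unit k

c^x-shift : ∀ n i → c^x (2 ℕ.+ n) (3 ℕ.+ i) ≡ false ∷ false ∷ c^x n (suc i)
c^x-shift n zero = refl
c^x-shift n (suc i) with isEven i
... | true  = refl
... | false = refl

lincomb-c^x : ∀ {n} (v : Vec Bool n) → lincomb (c^x n) v ≡ xᶜ v
lincomb-c^x []           = refl
lincomb-c^x (true ∷ [])  = refl
lincomb-c^x (false ∷ []) = refl
lincomb-c^x {suc (suc n)} (x ∷ y ∷ v) = begin
  X ⊕ (Y ⊕ lincomb (λ k → c^x (2 ℕ.+ n) (2 ℕ.+ k)) v)
    ≡⟨ cong (λ l → X ⊕ (Y ⊕ l)) (lincomb-shift {h₁ = λ _ → false} {h₂ = λ _ → false} (c^x-shift n) v) ⟩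
  X ⊕ (Y ⊕ (dot (λ _ → false) v ∷ dot (λ _ → false) v ∷ lincomb (c^x n) v))
    ≡⟨ cong₂ (λ d l → X ⊕ (Y ⊕ (d ∷ d ∷ l))) (dot-false (λ _ → refl) v) (lincomb-c^x v) ⟩
  X ⊕ (Y ⊕ (false ∷ false ∷ xᶜ v))
    ≡⟨ first-pair x y ⟩
  (x xor y) ∷ y ∷ xᶜ v ∎
  where
    open ≡-Reasoning
    X Y : Vec Bool (2 ℕ.+ n)
    X = if x then c^x (2 ℕ.+ n) 1 else 0⃗
    Y = if y then c^x (2 ℕ.+ n) 2 else 0⃗
    u₀ = unit {n} 0
    first-pair : ∀ x y → (if x then c^x (2 ℕ.+ n) 1 else 0⃗) ⊕ ((if y then c^x (2 ℕ.+ n) 2 else 0⃗) ⊕ (false ∷ false ∷ xᶜ v))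
                         ≡ (x xor y) ∷ y ∷ xᶜ v
    first-pair true  true  = cong (λ r → false ∷ true ∷ r) (0⃗-⊕-0⃗-⊕ u₀ (u₀ ⊕ u₀) _ unit-zero (⊕-self u₀))
    first-pair true  false = cong (λ r → true ∷ false ∷ r) (0⃗-⊕-0⃗-⊕ u₀ 0⃗ _ unit-zero refl)
    first-pair false true  = cong (λ r → true ∷ true ∷ r) (0⃗-⊕-0⃗-⊕ 0⃗ (u₀ ⊕ u₀) _ refl (⊕-self u₀))
    first-pair false false = cong (λ r → false ∷ false ∷ r) (0⃗-⊕-0⃗-⊕ 0⃗ 0⃗ _ refl refl)

pairSum : ∀ {n} → Vec Bool n → Bool
pairSum []          = false
pairSum (x ∷ [])    = false
pairSum (x ∷ y ∷ _) = x xor y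

-- c_{2i+1} ↦ c_{2i-1} c_{2i} c_{2i+2}, c_{2i+2} ↦ c_{2i-1} c_{2i} c_{2i+1}, a final unpaired c_k ↦ c_k
τᶜ : ∀ {n} → Vec Bool n → Vec Bool n
τᶜ []          = []
τᶜ (x ∷ [])    = x ∷ []
τᶜ (x ∷ y ∷ v) = (y xor pairSum v) ∷ (x xor pairSum v) ∷ τᶜ v

pairSum-τᶜ : ∀ {n} (v : Vec Bool n) → pairSum (τᶜ v) ≡ pairSum v
pairSum-τᶜ []          = refl
pairSum-τᶜ (x ∷ [])    = refl
pairSum-τᶜ (x ∷ y ∷ v) = begin
  (y xor s) xor (x xor s)   ≡⟨ cong ((y xor s) xor_) (xor-comm x s) ⟩
  (y xor s) xor (s xor x)   ≡⟨ xor-assoc (y xor s) s x ⟨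
  ((y xor s) xor s) xor x   ≡⟨ cong (_xor x) (xor-cancelʳ y s) ⟩
  y xor x                   ≡⟨ xor-comm y x ⟩
  x xor y                   ∎
  where
    open ≡-Reasoning
    s = pairSum v

τᶜ-involutive : ∀ {n} (v : Vec Bool n) → τᶜ (τᶜ v) ≡ v
τᶜ-involutive []          = refl
τᶜ-involutive (x ∷ [])    = refl
τᶜ-involutive (x ∷ y ∷ v) rewrite pairSum-τᶜ v =
  cong₂ _∷_ (xor-cancelʳ x (pairSum v)) (cong₂ _∷_ (xor-cancelʳ y (pairSum v)) (τᶜ-involutive v))

τᶜ-injective : ∀ {n} → Injective _≡_ _≡_ (τᶜ {n})
τᶜ-injective = involutive⇒injective τᶜ-involutive

-- the c-part of c_k^τ in H (3 + n), with the conjunction of τC swapped so that the test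
-- reduces as soon as k ≢ n is evident
c^τ : ∀ n → ℕ → Vec Bool n
c^τ n k = if isEven k then unit (k ∸ 3) ⊕ unit (k ∸ 2) ⊕ unit (k ∸ 1)
          else if (k ≡ᵇ n) ∧ isEven (suc n) then unit k
          else unit (k ∸ 2) ⊕ unit (k ∸ 1) ⊕ unit (suc k)

c^τ-shift : ∀ n i → c^τ (4 ℕ.+ n) (3 ℕ.+ i) ≡ (i <ᵇ 2) ∷ (i <ᵇ 2) ∷ c^τ (2 ℕ.+ n) (suc i)
c^τ-shift n 0 = refl
c^τ-shift n 1 = refl
c^τ-shift n 2 with (1 ≡ᵇ n) ∧ isEven (suc n)
... | true  = refl
... | false = refl
c^τ-shift n (suc (suc (suc j))) with isEven j
... | true  = refl
... | false with (suc (suc j) ≡ᵇ n) ∧ isEven (suc n)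
...   | true  = refl
...   | false = refl

dot-<ᵇ3 : ∀ {n} (v : Vec Bool (2 ℕ.+ n)) → dot (_<ᵇ 3) v ≡ pairSum v
dot-<ᵇ3 (z ∷ w ∷ v) rewrite ∧-identityʳ z | ∧-identityʳ w | dot-false {h = λ k → 2 ℕ.+ k <ᵇ 3} (λ _ → refl) v =
  cong (z xor_) (xor-identityʳ w)

-- c^τ-shift needs a tail of length ≥ 2, so lengths ≤ 3 (where c_{m-3}^τ = c_{m-3} for m = 6) are computed
lincomb-c^τ : ∀ {n} (v : Vec Bool n) → lincomb (c^τ n) v ≡ τᶜ v
lincomb-c^τ []                            = refl
lincomb-c^τ (true ∷ [])                   = refl
lincomb-c^τ (false ∷ [])                  = refl
lincomb-c^τ (true ∷ true ∷ [])            = refl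
lincomb-c^τ (true ∷ false ∷ [])           = refl
lincomb-c^τ (false ∷ true ∷ [])           = refl
lincomb-c^τ (false ∷ false ∷ [])          = refl
lincomb-c^τ (true ∷ true ∷ true ∷ [])     = refl
lincomb-c^τ (true ∷ true ∷ false ∷ [])    = refl
lincomb-c^τ (true ∷ false ∷ true ∷ [])    = refl
lincomb-c^τ (true ∷ false ∷ false ∷ [])   = refl
lincomb-c^τ (false ∷ true ∷ true ∷ [])    = refl
lincomb-c^τ (false ∷ true ∷ false ∷ [])   = refl
lincomb-c^τ (false ∷ false ∷ true ∷ [])   = refl
lincomb-c^τ (false ∷ false ∷ false ∷ [])  = refl
lincomb-c^τ {suc (suc (suc (suc n)))} (x ∷ y ∷ v) = begin
  X ⊕ (Y ⊕ lincomb (λ k → c^τ (4 ℕ.+ n) (2 ℕ.+ k)) v)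
    ≡⟨ cong (λ l → X ⊕ (Y ⊕ l)) (lincomb-shift {h₁ = _<ᵇ 3} {h₂ = _<ᵇ 3} (c^τ-shift n) v) ⟩
  X ⊕ (Y ⊕ (dot (_<ᵇ 3) v ∷ dot (_<ᵇ 3) v ∷ lincomb (c^τ (2 ℕ.+ n)) v))
    ≡⟨ cong₂ (λ d l → X ⊕ (Y ⊕ (d ∷ d ∷ l))) (dot-<ᵇ3 v) (lincomb-c^τ v) ⟩
  X ⊕ (Y ⊕ (pairSum v ∷ pairSum v ∷ τᶜ v))
    ≡⟨ first-pair x y ⟩
  (y xor pairSum v) ∷ (x xor pairSum v) ∷ τᶜ v ∎
  where
    open ≡-Reasoning
    X Y : Vec Bool (4 ℕ.+ n)
    X = if x then c^τ (4 ℕ.+ n) 1 else 0⃗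
    Y = if y then c^τ (4 ℕ.+ n) 2 else 0⃗
    w₀ = unit {2 ℕ.+ n} 0 ⊕ unit 0 ⊕ unit 0
    w₀≡0⃗ : w₀ ≡ 0⃗
    w₀≡0⃗ = trans (cong (_⊕ unit 0) (⊕-self (unit 0))) (trans (⊕-identityˡ (unit 0)) unit-zero)
    heads : ∀ x y → Vec Bool (2 ℕ.+ n) → Vec Bool (4 ℕ.+ n)
    heads x y r = (y xor pairSum v) ∷ (x xor pairSum v) ∷ r
    first-pair : ∀ x y → (if x then c^τ (4 ℕ.+ n) 1 else 0⃗) ⊕ ((if y then c^τ (4 ℕ.+ n) 2 else 0⃗) ⊕ (pairSum v ∷ pairSum v ∷ τᶜ v))
                         ≡ heads x y (τᶜ v)
    first-pair true  true  = cong (heads true true) (0⃗-⊕-0⃗-⊕ w₀ w₀ _ w₀≡0⃗ w₀≡0⃗)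
    first-pair true  false = cong (heads true false) (0⃗-⊕-0⃗-⊕ w₀ 0⃗ _ w₀≡0⃗ refl)
    first-pair false true  = cong (heads false true) (0⃗-⊕-0⃗-⊕ 0⃗ w₀ _ refl w₀≡0⃗)
    first-pair false false = cong (heads false false) (0⃗-⊕-0⃗-⊕ 0⃗ 0⃗ _ refl refl)

-- H as D₈ × 𝔽₂^(m-3)

module _ {m : ℕ} where

  dPart : H m → D
  dPart (mk i j _) = i , j

  cPart : H m → Vec Bool (m ∸ 3)
  cPart (mk _ _ v) = v

  toPair : H m → D × Vec Bool (m ∸ 3)
  toPair g = dPart g , cPart g

  fromPair : D × Vec Bool (m ∸ 3) → H m
  fromPair ((i , j) , v) = mk i j v

  fromPair-toPair : ∀ g → fromPair (toPair g) ≡ g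
  fromPair-toPair (mk _ _ _) = refl

  ≡-fromPair : ∀ {g d v} → dPart g ≡ d → cPart g ≡ v → g ≡ fromPair (d , v)
  ≡-fromPair {mk _ _ _} refl refl = refl

  -- does (u ≟H v) reduces to u == v on constructors, so transpositions agree with swap
  _≟H_ : DecidableEquality (H m)
  mk i j u ≟H mk k l v =
    map′ (λ { (refl , refl , refl) → refl }) (λ { refl → refl , refl , refl })
         (i Fin.≟ k ×-dec j Bool.≟ l ×-dec Vec.≡-dec Bool._≟_ u v)

  transpose≡swap : ∀ u v w → Transpositions.transpose _≟H_ u v w ≡ swap u v w
  transpose≡swap (mk _ _ _) (mk _ _ _) (mk _ _ _) = refl

  dPart-· : ∀ g h → dPart (g · h) ≡ dPart g ∙ dPart h
  dPart-· (mk _ _ _) (mk _ _ _) = refl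

  cPart-· : ∀ g h → cPart (g · h) ≡ cPart g ⊕ cPart h
  cPart-· (mk _ _ _) (mk _ _ _) = refl

  dPart-^ : ∀ g n → dPart (g ^ n) ≡ dPart g ^ᴰ n
  dPart-^ g zero    = refl
  dPart-^ g (suc n) = trans (dPart-· (g ^ n) g) (cong (_∙ dPart g) (dPart-^ g n))

  cPart-^ : ∀ {g} n → cPart g ≡ 0⃗ → cPart (g ^ n) ≡ 0⃗
  cPart-^ zero    _    = refl
  cPart-^ {g} (suc n) g≡0⃗ =
    trans (cPart-· (g ^ n) g) (trans (cong₂ _⊕_ (cPart-^ n g≡0⃗) g≡0⃗) (⊕-identityˡ 0⃗))

  dPart-if : ∀ j (g : H m) → dPart (if j then g else e) ≡ (if j then dPart g else 1ᴰ)
  dPart-if true  _ = refl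
  dPart-if false _ = refl

  cPart-if : ∀ j (g : H m) → cPart (if j then g else e) ≡ (if j then cPart g else 0⃗)
  cPart-if true  _ = refl
  cPart-if false _ = refl

  -- cprod, for vectors of any length
  ∏ : ∀ {k} → (ℕ → H m) → Vec Bool k → H m
  ∏ C v = foldr _ _·_ e (tabulate λ p → if lookup v p then C (suc (Fin.toℕ p)) else e)

  cPart-∏ : ∀ {k} C (v : Vec Bool k) → cPart (∏ C v) ≡ lincomb (cPart ∘ C) v
  cPart-∏ C []      = refl
  cPart-∏ C (x ∷ v) =
    trans (cPart-· (if x then C 1 else e) (∏ (C ∘ suc) v)) (cong₂ _⊕_ (cPart-if x (C 1)) (cPart-∏ (C ∘ suc) v))

  dPart-∏ : ∀ {k C} → (∀ k → dPart (C k) ≡ 1ᴰ) → (v : Vec Bool k) → dPart (∏ C v) ≡ 1ᴰ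
  dPart-∏         C₁ []      = refl
  dPart-∏ {C = C} C₁ (x ∷ v) =
    trans (dPart-· (if x then C 1 else e) (∏ (C ∘ suc) v))
          (cong₂ _∙_ (trans (dPart-if x (C 1)) (if-1ᴰ x)) (dPart-∏ (C₁ ∘ suc) v))
    where
      if-1ᴰ : ∀ x → (if x then dPart (C 1) else 1ᴰ) ≡ 1ᴰ
      if-1ᴰ true  = C₁ 1
      if-1ᴰ false = refl

  dPart-prodUpTo : ∀ {f} → (∀ k → dPart (f k) ≡ 1ᴰ) → ∀ n → dPart (prodUpTo f n) ≡ 1ᴰ
  dPart-prodUpTo f₁ zero    = f₁ 0
  dPart-prodUpTo f₁ (suc n) = trans (dPart-· _ _) (cong₂ _∙_ (dPart-prodUpTo f₁ n) (f₁ (suc n)))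

  -- x and τ both send  a^i b^j ∏ c_k^{v_k}  to a monomial  A^n B^j ∏ (C k)^{v_k}
  monomial : ∀ {k} → H m → H m → (ℕ → H m) → ℕ → Bool → Vec Bool k → H m
  monomial A B C n j v = A ^ n · (if j then B else e) · ∏ C v

  dPart-monomial : ∀ {k} A B C n j (v : Vec Bool k) →
                   dPart (monomial A B C n j v) ≡ dPart A ^ᴰ n ∙ (if j then dPart B else 1ᴰ) ∙ dPart (∏ C v)
  dPart-monomial A B C n j v =
    trans (dPart-· _ (∏ C v)) (cong (_∙ dPart (∏ C v)) (trans (dPart-· (A ^ n) _) (cong₂ _∙_ (dPart-^ A n) (dPart-if j B))))

  cPart-monomial : ∀ {k A B} C n j (v : Vec Bool k) → cPart A ≡ 0⃗ → cPart B ≡ 0⃗ →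
                   cPart (monomial A B C n j v) ≡ lincomb (cPart ∘ C) v
  cPart-monomial {A = A} {B} C n j v A≡0⃗ B≡0⃗ = begin
    cPart (monomial A B C n j v)                          ≡⟨ cPart-· (A ^ n · (if j then B else e)) (∏ C v) ⟩
    cPart (A ^ n · (if j then B else e)) ⊕ cPart (∏ C v)  ≡⟨ cong (_⊕ cPart (∏ C v)) (prefix≡0⃗ j) ⟩
    0⃗ ⊕ cPart (∏ C v)                                     ≡⟨ ⊕-identityˡ _ ⟩
    cPart (∏ C v)                                         ≡⟨ cPart-∏ C v ⟩
    lincomb (cPart ∘ C) v                                 ∎
    where
      open ≡-Reasoning
      prefix≡0⃗ : ∀ j → cPart (A ^ n · (if j then B else e)) ≡ 0⃗
      prefix≡0⃗ true  = trans (cPart-· (A ^ n) B) (trans (cong₂ _⊕_ (cPart-^ n A≡0⃗) B≡0⃗) (⊕-identityˡ 0⃗))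
      prefix≡0⃗ false = trans (cPart-· (A ^ n) e) (trans (cong (_⊕ 0⃗) (cPart-^ n A≡0⃗)) (⊕-identityˡ 0⃗))

  cPart-xC : ∀ k → cPart (xC m k) ≡ c^x (m ∸ 3) k
  cPart-xC k with isEven k
  ... | true  = cong (_⊕ unit k) (trans (cong (_⊕ unit (k ∸ 1)) (⊕-identityˡ 0⃗)) (⊕-identityˡ _))
  ... | false with isEven m ∧ (k ≡ᵇ (m ∸ 3))
  ...   | true  = trans (cong (_⊕ unit k) (⊕-identityˡ 0⃗)) (⊕-identityˡ _)
  ...   | false = refl

  dPart-τC : ∀ k → dPart (τC m k) ≡ 1ᴰ
  dPart-τC k with isEven k
  ... | true  = refl
  ... | false with isEven m ∧ (k ≡ᵇ (m ∸ 3))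
  ...   | true  = refl
  ...   | false = refl

cPart-τC : ∀ n k → cPart (τC (3 ℕ.+ n) k) ≡ c^τ n k
cPart-τC n k with isEven k
... | true  = refl
... | false rewrite ∧-comm (isEven (suc n)) (k ≡ᵇ n) with (k ≡ᵇ n) ∧ isEven (suc n)
...   | true  = refl
...   | false = refl

module _ {m : ℕ} where
  open Transpositions (_≟H_ {m})

  Decomposition : Parity → (H m → H m) → Set
  Decomposition 0ℙ f = InAlt m f
  Decomposition 1ℙ f =
    Σ (H m) λ u → Σ (H m) λ v → u ≢ v × Σ (H m → H m) λ g → EvenProd m g × f ≗ swap u v ∘ g

  decompose : ∀ {f p} → HasParity f p → Decomposition p f
  decompose even-id = id , ep-id , λ _ → refl
  decompose (transpose-∘ {f} {0ℙ} u v u≢v F) with g , G , f≗g ← decompose F =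
    u , v , u≢v , g , G , λ w → trans (transpose≡swap u v (f w)) (cong (swap u v) (f≗g w))
  decompose (transpose-∘ {f} {1ℙ} u v u≢v F) with u₀ , v₀ , u₀≢v₀ , g , G , f≗ ← decompose F =
    swap u v ∘ swap u₀ v₀ ∘ g , ep-step u₀ v₀ u v u₀≢v₀ u≢v G ,
    λ w → trans (transpose≡swap u v (f w)) (cong (swap u v) (f≗ w))
  decompose (resp-≗ {p = 0ℙ} f≗f′ F) with g , G , f≗g ← decompose F =
    g , G , λ w → trans (sym (f≗f′ w)) (f≗g w)
  decompose (resp-≗ {p = 1ℙ} f≗f′ F) with u , v , u≢v , g , G , f≗ ← decompose F =
    u , v , u≢v , g , G , λ w → trans (sym (f≗f′ w)) (f≗ w)

-- The generators are even

module Generators (n : ℕ) where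
  private
    m : ℕ
    m = 3 ℕ.+ suc n

    V : Set
    V = Vec Bool (suc n)

    _≟V_ : DecidableEquality V
    _≟V_ = Vec.≡-dec Bool._≟_

    V-enumeration : Enumeration V
    V-enumeration = Vec-enumeration Bool-enumeration (suc n)

  open Transpositions (×-≡-dec _≟D_ _≟V_) using ()
    renaming (HasParity to HasParityᴾ; ∘-hasParity to ∘-hasParityᴾ)
  open Transpositions (_≟H_ {m}) using (HasParity; even-id; resp-≗; ∘-hasParity; rightInverse-hasParity)

  fibrewise₁-even : ∀ {ψ : V → D → D} {p} → (∀ v → HasParityᴰ (ψ v) p) → HasParityᴾ (fibrewise₁ ψ) 0ℙ
  fibrewise₁-even {p = p} Ψ =
    subst (HasParityᴾ _) (paritySum-const-Vec p n) (Fibrewise.fibrewise₁-hasParity _≟D_ _≟V_ V-enumeration Ψ)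

  fibrewise₂-even : ∀ {μ : Fin 4 → V → V} → (∀ i → Injective _≡_ _≡_ (μ i)) →
                    HasParityᴾ (fibrewise₂ (μ ∘ proj₁)) 0ℙ
  fibrewise₂-even {μ} μ-inj =
    subst (HasParityᴾ _) (paritySum-doubled (proj₁ ∘ parity) (allFin 4))
      (fibrewise₂-hasParity _≟D_ _≟V_ D-enumeration (proj₂ ∘ parity ∘ proj₁))
    where
      parity : ∀ i → ∃ (Transpositions.HasParity _≟V_ (μ i))
      parity i = Transpositions.injective⇒hasParity _≟V_ (complete V-enumeration) (μ i) (μ-inj i)

  fromPair-hasParity : ∀ {σ f p} → HasParityᴾ σ p →
                       (∀ d v → f (fromPair (d , v)) ≡ fromPair (σ (d , v))) → HasParity f p
  fromPair-hasParity P f≡ =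
    resp-≗ (λ { (mk i j v) → sym (f≡ (i , j) v) })
           (conjugate-hasParity _≟H_ (×-≡-dec _≟D_ _≟V_) toPair fromPair (λ _ → refl) fromPair-toPair P)

  R-even : ∀ g → HasParity (R g) 0ℙ
  R-even (mk k l w) =
    fromPair-hasParity (∘-hasParityᴾ (fibrewise₁-even λ _ → rightMul-even (k , l))
                                     (fibrewise₂-even λ _ → ⊕-injectiveʳ w))
                       λ _ _ → refl

  xᴰ : D → D
  xᴰ (i , j) = (aᴰ ^ᴰ 3) ^ᴰ Fin.toℕ i ∙ (if j then aᴰ ∙ bᴰ else 1ᴰ)

  xmap-pair : ∀ d v → xmap m (fromPair (d , v)) ≡ fromPair (xᴰ d ∙ dPart (∏ (xC m) v) , xᶜ v)
  xmap-pair (i , j) v =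
    ≡-fromPair (dPart-monomial (a ^ 3) (a · b) (xC m) (Fin.toℕ i) j v)
               (trans (cPart-monomial (xC m) (Fin.toℕ i) j v (cPart-^ {g = a {m}} 3 refl) (⊕-identityˡ 0⃗))
                      (trans (lincomb-cong (cPart-xC ∘ suc) v) (lincomb-c^x v)))

  -- ψ_v is xᴰ followed by a right multiplication, and right multiplications of D₈ are even
  x-even : HasParity (xmap m) 0ℙ
  x-even = fromPair-hasParity
    (∘-hasParityᴾ (fibrewise₁-even λ v → ∘-hasParityᴰ (proj₂ (hasParityᴰ xᴰ)) (rightMul-even (dPart (∏ (xC m) v))))
                  (fibrewise₂-even λ _ → xᶜ-injective))
    xmap-pair

  τᴰ : D → D
  τᴰ (i , j) = bᴰ ^ᴰ (Fin.toℕ i / 2) ∙ (if j then aᴰ ∙ aᴰ else 1ᴰ)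

  τmap-pair : ∀ d w → τmap m (fromPair (d , w)) ≡ fromPair (τᴰ d , τᶜ w)
  τmap-pair (i , j) w =
    ≡-fromPair (trans (dPart-monomial b (a · a) (τC m) (Fin.toℕ i / 2) j w)
                      (trans (cong (τᴰ (i , j) ∙_) (dPart-∏ dPart-τC w)) (∙-identityʳ (τᴰ (i , j)))))
               (trans (cPart-monomial (τC m) (Fin.toℕ i / 2) j w refl (⊕-identityˡ 0⃗))
                      (trans (lincomb-cong (cPart-τC (suc n) ∘ suc) w) (lincomb-c^τ w)))

  private
    t : H m
    t = if isEven m then c (m ∸ 3) else e

    dPart-t : dPart t ≡ 1ᴰ
    dPart-t with isEven m
    ... | true  = refl
    ... | false = refl

    hᶜ tᶜ : V
    hᶜ = cPart (h m)
    tᶜ = cPart t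

    h≡ : h m ≡ fromPair (aᴰ , hᶜ)
    h≡ = ≡-fromPair (trans (dPart-· a _) (cong (aᴰ ∙_) (dPart-prodUpTo (λ _ → refl) ((m ∸ 4) / 2)))) refl

  yᴰ : D → D
  yᴰ (i , j) = if isEven (Fin.toℕ i) then τᴰ (i , j) else aᴰ ∙ τᴰ (3F +₄ i , j)

  yᶜ : Fin 4 → V → V
  yᶜ i v = if isEven (Fin.toℕ i) then τᶜ v else hᶜ ⊕ τᶜ (hᶜ ⊕ v) ⊕ tᶜ

  ymap-hK : ∀ i j v → h m · τmap m (inv (h m) · mk i j v) · t ≡
                      fromPair (aᴰ ∙ τᴰ (3F +₄ i , j) , hᶜ ⊕ τᶜ (hᶜ ⊕ v) ⊕ tᶜ)
  ymap-hK i j v = begin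
    h m · τmap m (inv (h m) · mk i j v) · t
      ≡⟨ cong (λ g → g · τmap m (inv g · mk i j v) · t) h≡ ⟩
    mk 1F false hᶜ · τmap m (mk (3F +₄ i) j (hᶜ ⊕ v)) · t
      ≡⟨ cong (λ g → mk 1F false hᶜ · g · t) (τmap-pair (3F +₄ i , j) (hᶜ ⊕ v)) ⟩
    g · t
      ≡⟨ ≡-fromPair (trans (dPart-· g t) (trans (cong (dPart g ∙_) dPart-t) (∙-identityʳ (dPart g)))) (cPart-· g t) ⟩
    fromPair (aᴰ ∙ τᴰ (3F +₄ i , j) , hᶜ ⊕ τᶜ (hᶜ ⊕ v) ⊕ tᶜ) ∎
    where
      open ≡-Reasoning
      g = mk 1F false hᶜ · fromPair (τᴰ (3F +₄ i , j) , τᶜ (hᶜ ⊕ v))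

  ymap-pair : ∀ d v → ymap m (fromPair (d , v)) ≡ fromPair (yᴰ d , yᶜ (proj₁ d) v)
  ymap-pair (0F , j) v = τmap-pair (0F , j) v
  ymap-pair (1F , j) v = ymap-hK 1F j v
  ymap-pair (2F , j) v = τmap-pair (2F , j) v
  ymap-pair (3F , j) v = ymap-hK 3F j v

  yᶜ-injective : ∀ i → Injective _≡_ _≡_ (yᶜ i)
  yᶜ-injective 0F = τᶜ-injective
  yᶜ-injective 1F = ⊕-injectiveˡ hᶜ ∘ τᶜ-injective ∘ ⊕-injectiveˡ hᶜ ∘ ⊕-injectiveʳ tᶜ
  yᶜ-injective 2F = τᶜ-injective
  yᶜ-injective 3F = ⊕-injectiveˡ hᶜ ∘ τᶜ-injective ∘ ⊕-injectiveˡ hᶜ ∘ ⊕-injectiveʳ tᶜ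

  y-even : HasParity (ymap m) 0ℙ
  y-even = fromPair-hasParity
    (∘-hasParityᴾ (fibrewise₂-even yᶜ-injective) (fibrewise₁-even λ _ → proj₂ (hasParityᴰ yᴰ)))
    ymap-pair

  generated-even : ∀ {σ} → InGen m σ → HasParity σ 0ℙ
  generated-even gen-x                 = x-even
  generated-even gen-y                 = y-even
  generated-even (gen-R g)             = R-even g
  generated-even gen-id                = even-id
  generated-even (gen-mul F G)         = ∘-hasParity (generated-even F) (generated-even G)
  generated-even (gen-inv F _ f∘f′≗id) = rightInverse-hasParity (generated-even F) f∘f′≗id
  generated-even (gen-ext F f≗g)       = resp-≗ f≗g (generated-even F)

lemma2p3 : (m : ℕ) → 4 ≤ m → (σ : H m → H m) → InGen m σ → InAlt m σ
lemma2p3 _ (s≤s (s≤s (s≤s (s≤s {n = n} z≤n)))) σ σ∈G = decompose (Generators.generated-even n σ∈G)
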